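{- For non-negative integers $m,n,r$ with $n\geq r$: (a) $\mathcal{K}_{n-r}\mathcal{K}_{n+r}=\mathcal{K}_{n}^{2}$; (b) $\mathcal{K}_{n}^{m}=\mathcal{K}_{0}^{m}\mathcal{T}_{mn}$.
   Context: The Tribonacci matrix sequence $(\mathcal{T}_n)_{n\geq 0}$ and Tribonacci–Lucas matrix sequence $(\mathcal{K}_n)_{n\geq 0}$ of $3\times 3$ matrices are defined by $\mathcal{T}_n=\mathcal{T}_{n-1}+\mathcal{T}_{n-2}+\mathcal{T}_{n-3}$ and $\mathcal{K}_n=\mathcal{K}_{n-1}+\mathcal{K}_{n-2}+\mathcal{K}_{n-3}$ for $n\geq 3$, with $\mathcal{T}_0=\begin{pmatrix}1&0&0\\0&1&0\\0&0&1\end{pmatrix}$, $\mathcal{T}_1=\begin{pmatrix}1&1&1\\1&0&0\\0&1&0\end{pmatrix}$, $\mathcal{T}_2=\begin{pmatrix}2&2&1\\1&1&1\\1&0&0\end{pmatrix}$, and $\mathcal{K}_0=\begin{pmatrix}1&2&3\\3&-2&-1\\-1&4&-1\end{pmatrix}$, $\mathcal{K}_1=\begin{pmatrix}3&4&1\\1&2&3\\3&-2&-1\end{pmatrix}$, $\mathcal{K}_2=\begin{pmatrix}7&4&3\\3&4&1\\1&2&3\end{pmatrix}$. Matrix powers are ordinary matrix products, with $M^0$ the identity. -}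

module Defs where

open import Data.Nat using (ℕ; zero; suc)
open import Data.Integer using (ℤ; +_; -[1+_]; _+_; _*_)
open import Data.Fin using (Fin; zero; suc)
open import Relation.Binary.PropositionalEquality using (_≡_)

Mat : Set
Mat = Fin 3 → Fin 3 → ℤ

mat : ℤ → ℤ → ℤ → ℤ → ℤ → ℤ → ℤ → ℤ → ℤ → Mat
mat a b c d e f g h i zero    zero          = a
mat a b c d e f g h i zero    (suc zero)    = b
mat a b c d e f g h i zero    (suc (suc _)) = c
mat a b c d e f g h i (suc zero) zero          = d
mat a b c d e f g h i (suc zero) (suc zero)    = e
mat a b c d e f g h i (suc zero) (suc (suc _)) = f
mat a b c d e f g h i (suc (suc _)) zero          = g
mat a b c d e f g h i (suc (suc _)) (suc zero)    = h
mat a b c d e f g h i (suc (suc _)) (suc (suc _)) = i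

_⊕_ : Mat → Mat → Mat
(A ⊕ B) i j = A i j + B i j

_⊗_ : Mat → Mat → Mat
(A ⊗ B) i j = A i zero * B zero j + (A i (suc zero) * B (suc zero) j + A i (suc (suc zero)) * B (suc (suc zero)) j)

I₃ : Mat
I₃ = mat (+ 1) (+ 0) (+ 0) (+ 0) (+ 1) (+ 0) (+ 0) (+ 0) (+ 1)

_^^_ : Mat → ℕ → Mat
M ^^ zero = I₃
M ^^ suc m = M ⊗ (M ^^ m)

_≋_ : Mat → Mat → Set
A ≋ B = ∀ i j → A i j ≡ B i j

𝒯 : ℕ → Mat
𝒯 0 = I₃
𝒯 1 = mat (+ 1) (+ 1) (+ 1) (+ 1) (+ 0) (+ 0) (+ 0) (+ 1) (+ 0)
𝒯 2 = mat (+ 2) (+ 2) (+ 1) (+ 1) (+ 1) (+ 1) (+ 1) (+ 0) (+ 0)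
𝒯 (suc (suc (suc n))) = 𝒯 (suc (suc n)) ⊕ (𝒯 (suc n) ⊕ 𝒯 n)

𝒦 : ℕ → Mat
𝒦 0 = mat (+ 1) (+ 2) (+ 3) (+ 3) -[1+ 1 ] -[1+ 0 ] -[1+ 0 ] (+ 4) -[1+ 0 ]
𝒦 1 = mat (+ 3) (+ 4) (+ 1) (+ 1) (+ 2) (+ 3) (+ 3) -[1+ 1 ] -[1+ 0 ]
𝒦 2 = mat (+ 7) (+ 4) (+ 3) (+ 3) (+ 4) (+ 1) (+ 1) (+ 2) (+ 3)
𝒦 (suc (suc (suc n))) = 𝒦 (suc (suc n)) ⊕ (𝒦 (suc n) ⊕ 𝒦 n)

{-# OPTIONS --safe #-}
-- Both sequences are governed by the companion matrix Q = 𝒯 1: 𝒯 n = Q ^ n and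
-- 𝒦 n = 𝒦 0 Q ^ n, since in each equation both sides satisfy the Tribonacci recurrence
-- and agree for n = 0, 1, 2. A direct computation shows that 𝒦 0 commutes with Q. Hence
-- 𝒦 a 𝒦 b = 𝒦 0 ² Q ^ (a + b) depends only on a + b, which gives (a), and
-- (𝒦 0 Q ^ n) ^ m = 𝒦 0 ^ m Q ^ (m n), which gives (b).
module Submission where

open import Defs
open import Data.Nat using (ℕ; zero; suc; _≤_)
open import Data.Nat.Properties using (+-assoc; +-comm; m∸n+n≡m)
open import Data.Product using (_×_; _,_)
open import Data.Fin using (zero; suc)
open import Data.Fin.Properties using (all?)
import Data.Integer as ℤ
open import Data.Integer.Tactic.RingSolver using (solve-∀)
open import Algebra.Bundles using (Monoid)
open import Algebra.Structures using (IsMonoid)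
open import Level using (Level; 0ℓ)
open import Relation.Binary.Definitions using (Decidable)
open import Relation.Binary.Structures using (IsEquivalence)
open import Relation.Binary.PropositionalEquality using (_≡_)
import Relation.Binary.PropositionalEquality as ≡
import Relation.Binary.Reasoning.Setoid
open import Relation.Nullary.Decidable using (from-yes)

module CommutingPowers {c ℓ : Level} (M : Monoid c ℓ) where
  open Monoid M
  open import Data.Nat using (_+_; _*_)
  open import Algebra.Properties.Semigroup semigroup
    using (uv≈wx⇒yu∙vz≈yw∙xz)
  import Algebra.Properties.Monoid.Mult M as Mult
  open import Relation.Binary.Reasoning.Setoid setoid

  infixr 8 _^_
  _^_ : Carrier → ℕ → Carrier
  x ^ n = n Mult.× x

  ^-homo-+ : ∀ x m n → x ^ (m + n) ≈ x ^ m ∙ x ^ n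
  ^-homo-+ x m n = Mult.×-homo-+ x m n

  ^-congˡ : ∀ {x y} n → x ≈ y → x ^ n ≈ y ^ n
  ^-congˡ n = Mult.×-congʳ n

  ^-assoc : ∀ x m n → (x ^ n) ^ m ≈ x ^ (m * n)
  ^-assoc x m n = Mult.×-assocˡ x m n

  Commute : Carrier → Carrier → Set ℓ
  Commute x y = x ∙ y ≈ y ∙ x

  commute-sym : ∀ {x y} → Commute x y → Commute y x
  commute-sym = sym

  commute-^ : ∀ {x y} → Commute x y → ∀ n → Commute x (y ^ n)
  commute-^ {x} {y} xy≈yx zero = trans (identityʳ x) (sym (identityˡ x))
  commute-^ {x} {y} xy≈yx (suc n) = begin
    x ∙ (y ∙ y ^ n)  ≈⟨ assoc x y (y ^ n) ⟨
    (x ∙ y) ∙ y ^ n  ≈⟨ ∙-congʳ xy≈yx ⟩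
    (y ∙ x) ∙ y ^ n  ≈⟨ assoc y x (y ^ n) ⟩
    y ∙ (x ∙ y ^ n)  ≈⟨ ∙-congˡ (commute-^ xy≈yx n) ⟩
    y ∙ (y ^ n ∙ x)  ≈⟨ assoc y (y ^ n) x ⟨
    (y ∙ y ^ n) ∙ x  ∎

  interchange : ∀ {y z} → Commute y z → ∀ x w → (x ∙ y) ∙ (z ∙ w) ≈ (x ∙ z) ∙ (y ∙ w)
  interchange yz≈zy x w = uv≈wx⇒yu∙vz≈yw∙xz yz≈zy x w

  ^-distrib-∙ : ∀ {x y} → Commute x y → ∀ n → (x ∙ y) ^ n ≈ x ^ n ∙ y ^ n
  ^-distrib-∙ {x} {y} xy≈yx zero = sym (identityˡ ε)
  ^-distrib-∙ {x} {y} xy≈yx (suc n) = begin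
    (x ∙ y) ∙ (x ∙ y) ^ n    ≈⟨ ∙-congˡ (^-distrib-∙ xy≈yx n) ⟩
    (x ∙ y) ∙ (x ^ n ∙ y ^ n) ≈⟨ interchange (commute-^ (commute-sym xy≈yx) n) x (y ^ n) ⟩
    (x ∙ x ^ n) ∙ (y ∙ y ^ n) ∎

≋-isEquivalence : IsEquivalence _≋_
≋-isEquivalence = record
  { refl  = λ i j → ≡.refl
  ; sym   = λ p i j → ≡.sym (p i j)
  ; trans = λ p q i j → ≡.trans (p i j) (q i j)
  }

open IsEquivalence ≋-isEquivalence
  using () renaming (refl to ≋-refl; sym to ≋-sym; trans to ≋-trans)

_≋?_ : Decidable _≋_
A ≋? B = all? λ i → all? λ j → A i j ℤ.≟ B i j

⊕-cong : ∀ {A A′ B B′} → A ≋ A′ → B ≋ B′ → (A ⊕ B) ≋ (A′ ⊕ B′)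
⊕-cong p q i j = ≡.cong₂ ℤ._+_ (p i j) (q i j)

⊗-cong : ∀ {A A′ B B′} → A ≋ A′ → B ≋ B′ → (A ⊗ B) ≋ (A′ ⊗ B′)
⊗-cong p q i j
  rewrite p i zero | p i (suc zero) | p i (suc (suc zero))
        | q zero j | q (suc zero) j | q (suc (suc zero)) j = ≡.refl

⊗-assoc : ∀ A B C → ((A ⊗ B) ⊗ C) ≋ (A ⊗ (B ⊗ C))
⊗-assoc A B C i j =
  entry (A i zero) (A i (suc zero)) (A i (suc (suc zero)))
        (B zero zero) (B zero (suc zero)) (B zero (suc (suc zero)))
        (B (suc zero) zero) (B (suc zero) (suc zero)) (B (suc zero) (suc (suc zero)))
        (B (suc (suc zero)) zero) (B (suc (suc zero)) (suc zero)) (B (suc (suc zero)) (suc (suc zero)))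
        (C zero j) (C (suc zero) j) (C (suc (suc zero)) j)
  where
  open import Data.Integer using (_+_; _*_)
  entry : ∀ a₀ a₁ a₂ b₀₀ b₀₁ b₀₂ b₁₀ b₁₁ b₁₂ b₂₀ b₂₁ b₂₂ c₀ c₁ c₂ →
    (a₀ * b₀₀ + (a₁ * b₁₀ + a₂ * b₂₀)) * c₀
      + ((a₀ * b₀₁ + (a₁ * b₁₁ + a₂ * b₂₁)) * c₁ + (a₀ * b₀₂ + (a₁ * b₁₂ + a₂ * b₂₂)) * c₂)
    ≡ a₀ * (b₀₀ * c₀ + (b₀₁ * c₁ + b₀₂ * c₂))
      + (a₁ * (b₁₀ * c₀ + (b₁₁ * c₁ + b₁₂ * c₂)) + a₂ * (b₂₀ * c₀ + (b₂₁ * c₁ + b₂₂ * c₂)))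
  entry = solve-∀

module UnitVectorDot where
  open import Data.Integer using (ℤ; +_; _+_; _*_)

  e₀·v : ∀ a b c → + 1 * a + (+ 0 * b + + 0 * c) ≡ a
  e₀·v = solve-∀
  e₁·v : ∀ a b c → + 0 * a + (+ 1 * b + + 0 * c) ≡ b
  e₁·v = solve-∀
  e₂·v : ∀ a b c → + 0 * a + (+ 0 * b + + 1 * c) ≡ c
  e₂·v = solve-∀
  v·e₀ : ∀ a b c → a * + 1 + (b * + 0 + c * + 0) ≡ a
  v·e₀ = solve-∀
  v·e₁ : ∀ a b c → a * + 0 + (b * + 1 + c * + 0) ≡ b
  v·e₁ = solve-∀
  v·e₂ : ∀ a b c → a * + 0 + (b * + 0 + c * + 1) ≡ c
  v·e₂ = solve-∀

open UnitVectorDot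

⊗-identityˡ : ∀ A → (I₃ ⊗ A) ≋ A
⊗-identityˡ A zero             j = e₀·v (A zero j) (A (suc zero) j) (A (suc (suc zero)) j)
⊗-identityˡ A (suc zero)       j = e₁·v (A zero j) (A (suc zero) j) (A (suc (suc zero)) j)
⊗-identityˡ A (suc (suc zero)) j = e₂·v (A zero j) (A (suc zero) j) (A (suc (suc zero)) j)

⊗-identityʳ : ∀ A → (A ⊗ I₃) ≋ A
⊗-identityʳ A i zero             = v·e₀ (A i zero) (A i (suc zero)) (A i (suc (suc zero)))
⊗-identityʳ A i (suc zero)       = v·e₁ (A i zero) (A i (suc zero)) (A i (suc (suc zero)))
⊗-identityʳ A i (suc (suc zero)) = v·e₂ (A i zero) (A i (suc zero)) (A i (suc (suc zero)))

⊗-distribˡ-⊕ : ∀ A B C → (A ⊗ (B ⊕ C)) ≋ ((A ⊗ B) ⊕ (A ⊗ C))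
⊗-distribˡ-⊕ A B C i j =
  entry (A i zero) (A i (suc zero)) (A i (suc (suc zero)))
        (B zero j) (B (suc zero) j) (B (suc (suc zero)) j)
        (C zero j) (C (suc zero) j) (C (suc (suc zero)) j)
  where
  open import Data.Integer using (_+_; _*_)
  entry : ∀ a₀ a₁ a₂ b₀ b₁ b₂ c₀ c₁ c₂ →
    a₀ * (b₀ + c₀) + (a₁ * (b₁ + c₁) + a₂ * (b₂ + c₂))
    ≡ (a₀ * b₀ + (a₁ * b₁ + a₂ * b₂)) + (a₀ * c₀ + (a₁ * c₁ + a₂ * c₂))
  entry = solve-∀

⊗-isMonoid : IsMonoid _≋_ _⊗_ I₃
⊗-isMonoid = record
  { isSemigroup = record
    { isMagma = record { isEquivalence = ≋-isEquivalence ; ∙-cong = ⊗-cong }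
    ; assoc   = ⊗-assoc
    }
  ; identity = ⊗-identityˡ , ⊗-identityʳ
  }

⊗-monoid : Monoid 0ℓ 0ℓ
⊗-monoid = record { isMonoid = ⊗-isMonoid }

open CommutingPowers ⊗-monoid
module ≋-Reasoning = Relation.Binary.Reasoning.Setoid (Monoid.setoid ⊗-monoid)
open import Data.Nat using (_+_; _*_; _∸_)

^^≋^ : ∀ M m → (M ^^ m) ≋ (M ^ m)
^^≋^ M zero    = ≋-refl
^^≋^ M (suc m) = ⊗-cong (≋-refl {M}) (^^≋^ M m)

record IsTribonacci (S : ℕ → Mat) : Set where
  constructor tribonacci
  field recurrence : ∀ n → S (suc (suc (suc n))) ≋ (S (suc (suc n)) ⊕ (S (suc n) ⊕ S n))

𝒯-isTribonacci : IsTribonacci 𝒯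
𝒯-isTribonacci = tribonacci λ n → ≋-refl

𝒦-isTribonacci : IsTribonacci 𝒦
𝒦-isTribonacci = tribonacci λ n → ≋-refl

isTribonacci-suc : ∀ {S} → IsTribonacci S → IsTribonacci (λ n → S (suc n))
isTribonacci-suc (tribonacci rec) = tribonacci λ n → rec (suc n)

isTribonacci-⊗ˡ : ∀ M {S} → IsTribonacci S → IsTribonacci (λ n → M ⊗ S n)
isTribonacci-⊗ˡ M {S} (tribonacci rec) = tribonacci λ n → begin
  M ⊗ S (3 + n)                                   ≈⟨ ⊗-cong (≋-refl {M}) (rec n) ⟩
  M ⊗ (S (2 + n) ⊕ (S (1 + n) ⊕ S n))             ≈⟨ ⊗-distribˡ-⊕ M (S (2 + n)) (S (1 + n) ⊕ S n) ⟩
  (M ⊗ S (2 + n)) ⊕ (M ⊗ (S (1 + n) ⊕ S n))       ≈⟨ ⊕-cong (≋-refl {M ⊗ S (2 + n)}) (⊗-distribˡ-⊕ M (S (1 + n)) (S n)) ⟩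
  (M ⊗ S (2 + n)) ⊕ ((M ⊗ S (1 + n)) ⊕ (M ⊗ S n)) ∎
  where open ≋-Reasoning

tribonacci-unique : ∀ {S S′} → IsTribonacci S → IsTribonacci S′ →
  S 0 ≋ S′ 0 → S 1 ≋ S′ 1 → S 2 ≋ S′ 2 → ∀ n → S n ≋ S′ n
tribonacci-unique _ _ e₀ e₁ e₂ 0 = e₀
tribonacci-unique _ _ e₀ e₁ e₂ 1 = e₁
tribonacci-unique _ _ e₀ e₁ e₂ 2 = e₂
tribonacci-unique {S} {S′} S-trib@(tribonacci rec) S′-trib@(tribonacci rec′) e₀ e₁ e₂ (suc (suc (suc n))) = begin
  S (3 + n)                             ≈⟨ rec n ⟩
  S (2 + n) ⊕ (S (1 + n) ⊕ S n)         ≈⟨ ⊕-cong (agree (suc (suc n))) (⊕-cong (agree (suc n)) (agree n)) ⟩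
  S′ (2 + n) ⊕ (S′ (1 + n) ⊕ S′ n)      ≈⟨ rec′ n ⟨
  S′ (3 + n)                            ∎
  where
  open ≋-Reasoning
  agree : ∀ k → S k ≋ S′ k
  agree = tribonacci-unique S-trib S′-trib e₀ e₁ e₂

𝒯-suc : ∀ n → 𝒯 (suc n) ≋ (𝒯 1 ⊗ 𝒯 n)
𝒯-suc = tribonacci-unique (isTribonacci-suc 𝒯-isTribonacci) (isTribonacci-⊗ˡ (𝒯 1) 𝒯-isTribonacci)
  (from-yes (𝒯 1 ≋? (𝒯 1 ⊗ 𝒯 0)))
  (from-yes (𝒯 2 ≋? (𝒯 1 ⊗ 𝒯 1)))
  (from-yes (𝒯 3 ≋? (𝒯 1 ⊗ 𝒯 2)))

𝒦≋𝒦₀⊗𝒯 : ∀ n → 𝒦 n ≋ (𝒦 0 ⊗ 𝒯 n)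
𝒦≋𝒦₀⊗𝒯 = tribonacci-unique 𝒦-isTribonacci (isTribonacci-⊗ˡ (𝒦 0) 𝒯-isTribonacci)
  (from-yes (𝒦 0 ≋? (𝒦 0 ⊗ 𝒯 0)))
  (from-yes (𝒦 1 ≋? (𝒦 0 ⊗ 𝒯 1)))
  (from-yes (𝒦 2 ≋? (𝒦 0 ⊗ 𝒯 2)))

𝒦₀-commutes-𝒯₁ : Commute (𝒦 0) (𝒯 1)
𝒦₀-commutes-𝒯₁ = from-yes ((𝒦 0 ⊗ 𝒯 1) ≋? (𝒯 1 ⊗ 𝒦 0))

𝒯≋power : ∀ n → 𝒯 n ≋ (𝒯 1 ^ n)
𝒯≋power zero    = ≋-refl
𝒯≋power (suc n) = ≋-trans (𝒯-suc n) (⊗-cong (≋-refl {𝒯 1}) (𝒯≋power n))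

𝒦≋𝒦₀⊗power : ∀ n → 𝒦 n ≋ (𝒦 0 ⊗ (𝒯 1 ^ n))
𝒦≋𝒦₀⊗power n = ≋-trans (𝒦≋𝒦₀⊗𝒯 n) (⊗-cong (≋-refl {𝒦 0}) (𝒯≋power n))

𝒦₀-commutes-power : ∀ n → Commute (𝒦 0) (𝒯 1 ^ n)
𝒦₀-commutes-power = commute-^ {𝒦 0} {𝒯 1} 𝒦₀-commutes-𝒯₁

𝒦-product : ∀ a b → (𝒦 a ⊗ 𝒦 b) ≋ ((𝒦 0 ⊗ 𝒦 0) ⊗ (𝒯 1 ^ (a + b)))
𝒦-product a b = begin
  𝒦 a ⊗ 𝒦 b                              ≈⟨ ⊗-cong (𝒦≋𝒦₀⊗power a) (𝒦≋𝒦₀⊗power b) ⟩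
  (𝒦 0 ⊗ (𝒯 1 ^ a)) ⊗ (𝒦 0 ⊗ (𝒯 1 ^ b))  ≈⟨ interchange {𝒯 1 ^ a} {𝒦 0} 𝒯₁^a-commutes-𝒦₀ (𝒦 0) (𝒯 1 ^ b) ⟩
  (𝒦 0 ⊗ 𝒦 0) ⊗ ((𝒯 1 ^ a) ⊗ (𝒯 1 ^ b))  ≈⟨ ⊗-cong (≋-refl {𝒦 0 ⊗ 𝒦 0}) (^-homo-+ (𝒯 1) a b) ⟨
  (𝒦 0 ⊗ 𝒦 0) ⊗ (𝒯 1 ^ (a + b))          ∎
  where
  open ≋-Reasoning
  𝒯₁^a-commutes-𝒦₀ : Commute (𝒯 1 ^ a) (𝒦 0)
  𝒯₁^a-commutes-𝒦₀ = commute-sym {𝒦 0} {𝒯 1 ^ a} (𝒦₀-commutes-power a)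

𝒦-product-depends-on-sum : ∀ a b c d → a + b ≡ c + d → (𝒦 a ⊗ 𝒦 b) ≋ (𝒦 c ⊗ 𝒦 d)
𝒦-product-depends-on-sum a b c d a+b≡c+d = begin
  𝒦 a ⊗ 𝒦 b                         ≈⟨ 𝒦-product a b ⟩
  (𝒦 0 ⊗ 𝒦 0) ⊗ (𝒯 1 ^ (a + b))     ≡⟨ ≡.cong (λ k → (𝒦 0 ⊗ 𝒦 0) ⊗ (𝒯 1 ^ k)) a+b≡c+d ⟩
  (𝒦 0 ⊗ 𝒦 0) ⊗ (𝒯 1 ^ (c + d))     ≈⟨ 𝒦-product c d ⟨
  𝒦 c ⊗ 𝒦 d                         ∎
  where open ≋-Reasoning

𝒦-power : ∀ m n → (𝒦 n ^^ m) ≋ ((𝒦 0 ^^ m) ⊗ 𝒯 (m * n))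
𝒦-power m n = begin
  𝒦 n ^^ m                              ≈⟨ ^^≋^ (𝒦 n) m ⟩
  𝒦 n ^ m                               ≈⟨ ^-congˡ m (𝒦≋𝒦₀⊗power n) ⟩
  (𝒦 0 ⊗ (𝒯 1 ^ n)) ^ m                 ≈⟨ ^-distrib-∙ {𝒦 0} (𝒦₀-commutes-power n) m ⟩
  (𝒦 0 ^ m) ⊗ ((𝒯 1 ^ n) ^ m)           ≈⟨ ⊗-cong (≋-sym (^^≋^ (𝒦 0) m)) (^-assoc (𝒯 1) m n) ⟩
  (𝒦 0 ^^ m) ⊗ (𝒯 1 ^ (m * n))          ≈⟨ ⊗-cong (≋-refl {𝒦 0 ^^ m}) (𝒯≋power (m * n)) ⟨
  (𝒦 0 ^^ m) ⊗ 𝒯 (m * n)                ∎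
  where open ≋-Reasoning

mainTheorem13 : (m n r : ℕ) → r ≤ n → ((𝒦 (n ∸ r) ⊗ 𝒦 (n + r)) ≋ (𝒦 n ^^ 2)) × ((𝒦 n ^^ m) ≋ ((𝒦 0 ^^ m) ⊗ 𝒯 (m * n)))
mainTheorem13 m n r r≤n = symmetric-product , 𝒦-power m n
  where
  indices-balance : (n ∸ r) + (n + r) ≡ n + n
  indices-balance = begin
    (n ∸ r) + (n + r)   ≡⟨ ≡.cong ((n ∸ r) +_) (+-comm n r) ⟩
    (n ∸ r) + (r + n)   ≡⟨ +-assoc (n ∸ r) r n ⟨
    (n ∸ r + r) + n     ≡⟨ ≡.cong (_+ n) (m∸n+n≡m r≤n) ⟩
    n + n               ∎
    where open ≡.≡-Reasoning

  symmetric-product : (𝒦 (n ∸ r) ⊗ 𝒦 (n + r)) ≋ (𝒦 n ^^ 2)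
  symmetric-product = begin
    𝒦 (n ∸ r) ⊗ 𝒦 (n + r)   ≈⟨ 𝒦-product-depends-on-sum (n ∸ r) (n + r) n n indices-balance ⟩
    𝒦 n ⊗ 𝒦 n               ≈⟨ ⊗-cong (≋-refl {𝒦 n}) (⊗-identityʳ (𝒦 n)) ⟨
    𝒦 n ^^ 2                ∎
    where open ≋-Reasoning
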